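{- Let $G$ be a graph. The maximum integer $k$ such that $G$ contains an induced subgraph isomorphic to $R_k$ is between $\lfloor\operatorname{sind}(G)/2\rfloor$ and $\operatorname{sind}(G)$. Consequently, if a graph excludes a threshold graph with $k$ vertices as an induced subgraph, then its strong index is smaller than $2k$.
   Context: $R_k$ has vertices $a_1,\dots,a_k,b_1,\dots,b_k$, edges $a_ib_j$ for all $1\le i\le j\le k$, the $a_i$ forming a clique and the $b_i$ an independent set, and no other edges. A threshold graph is a graph obtainable from the empty graph by iteratively adding a universal vertex or an isolated vertex. The strong index $\operatorname{sind}(G)$ is the maximum $k$ such that $G$ contains distinct vertices $a_1,\dots,a_k,b_1,\dots,b_k$ with: for all $1\le i<j\le k$, $a_i$ adjacent to $b_j$ and $b_i$ not adjacent to $a_j$; $a_1,\dots,a_k$ a clique; $b_1,\dots,b_k$ an independent set (no condition on adjacency of $a_i$ and $b_i$). -}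

module Defs where

open import Data.Nat using (ℕ; zero; suc; _+_; _≤_; _<_; _<ᵇ_; _≤ᵇ_; _≡ᵇ_)
open import Data.Bool using (Bool; true; false; if_then_else_; not)
open import Data.Fin using (Fin; toℕ; splitAt)
open import Data.Sum using (_⊎_; inj₁; inj₂)
open import Data.Vec using (Vec; lookup)
open import Data.Product using (Σ; _×_; _,_)
open import Relation.Binary.PropositionalEquality using (_≡_; refl; _≢_)
open import Function.Definitions using (Injective)

record Graph (n : ℕ) : Set where
  field
    adj    : Fin n → Fin n → Bool
    sym    : ∀ x y → adj x y ≡ adj y x
    irrefl : ∀ x → adj x x ≡ false
open Graph public

record InducedSub {m n : ℕ} (H : Graph m) (G : Graph n) : Set where
  field
    emb      : Fin m → Fin n
    emb-inj  : Injective _≡_ _≡_ emb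
    emb-adj  : ∀ x y → adj H x y ≡ adj G (emb x) (emb y)

Iso : {n : ℕ} → Graph n → Graph n → Set
Iso {n} H G = Σ (Fin n → Fin n) λ f →
  Injective _≡_ _≡_ f × (∀ x y → adj H x y ≡ adj G (f x) (f y))

≡ᵇ-sym : ∀ m n → (m ≡ᵇ n) ≡ (n ≡ᵇ m)
≡ᵇ-sym zero zero = refl
≡ᵇ-sym zero (suc n) = refl
≡ᵇ-sym (suc m) zero = refl
≡ᵇ-sym (suc m) (suc n) = ≡ᵇ-sym m n

≡ᵇ-refl : ∀ m → (m ≡ᵇ m) ≡ true
≡ᵇ-refl zero = refl
≡ᵇ-refl (suc m) = ≡ᵇ-refl m

<ᵇ-irrefl : ∀ m → (m <ᵇ m) ≡ false
<ᵇ-irrefl zero = refl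
<ᵇ-irrefl (suc m) = <ᵇ-irrefl m

-- R_k on vertex set Fin (k + k): the first k vertices are a_1..a_k,
-- the last k are b_1..b_k (indices shifted to start at 0).
-- a_i a_j adjacent iff i ≠ j; a_i b_j adjacent iff i ≤ j; b's independent.

RAdj : (k : ℕ) → Fin k ⊎ Fin k → Fin k ⊎ Fin k → Bool
RAdj k (inj₁ i) (inj₁ j) = not (toℕ i ≡ᵇ toℕ j)
RAdj k (inj₁ i) (inj₂ j) = toℕ i ≤ᵇ toℕ j
RAdj k (inj₂ i) (inj₁ j) = toℕ j ≤ᵇ toℕ i
RAdj k (inj₂ i) (inj₂ j) = false

RAdj-sym : ∀ k x y → RAdj k x y ≡ RAdj k y x
RAdj-sym k (inj₁ i) (inj₁ j) rewrite ≡ᵇ-sym (toℕ i) (toℕ j) = refl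
RAdj-sym k (inj₁ i) (inj₂ j) = refl
RAdj-sym k (inj₂ i) (inj₁ j) = refl
RAdj-sym k (inj₂ i) (inj₂ j) = refl

RAdj-irrefl : ∀ k x → RAdj k x x ≡ false
RAdj-irrefl k (inj₁ i) rewrite ≡ᵇ-refl (toℕ i) = refl
RAdj-irrefl k (inj₂ i) = refl

R : (k : ℕ) → Graph (k + k)
R k = record
  { adj    = λ x y → RAdj k (splitAt k x) (splitAt k y)
  ; sym    = λ x y → RAdj-sym k (splitAt k x) (splitAt k y)
  ; irrefl = λ x → RAdj-irrefl k (splitAt k x)
  }

HasInducedR : {n : ℕ} → Graph n → ℕ → Set
HasInducedR G k = InducedSub (R k) G

-- Strong index: witnesses for sind(G) ≥ k (indices 0..k-1)

record SindWitness {n : ℕ} (G : Graph n) (k : ℕ) : Set where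
  field
    a b       : Fin k → Fin n
    distinct  : Injective _≡_ _≡_ (λ (x : Fin k ⊎ Fin k) → Data.Sum.[ a , b ] x)
    ab-adj    : ∀ i j → toℕ i < toℕ j → adj G (a i) (b j) ≡ true
    ba-nonadj : ∀ i j → toℕ i < toℕ j → adj G (b i) (a j) ≡ false
    a-clique  : ∀ i j → i ≢ j → adj G (a i) (a j) ≡ true
    b-indep   : ∀ i j → adj G (b i) (b j) ≡ false

HasSind : {n : ℕ} → Graph n → ℕ → Set
HasSind G k = SindWitness G k

IsMax : (ℕ → Set) → ℕ → Set
IsMax P m = P m × (∀ k → P k → k ≤ m)

-- A construction sequence bs : Vec Bool n builds a graph
-- on Fin n by adding vertex 0, 1, ..., n-1 in order; vertex i is added as
-- a universal vertex if lookup bs i ≡ true, as an isolated vertex otherwise.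
-- So for i < j, i and j are adjacent iff j was added as universal.

thrAdj : {n : ℕ} → Vec Bool n → Fin n → Fin n → Bool
thrAdj bs i j =
  if toℕ i <ᵇ toℕ j then lookup bs j
  else if toℕ j <ᵇ toℕ i then lookup bs i
  else false

<ᵇ-asym : ∀ m n → (m <ᵇ n) ≡ true → (n <ᵇ m) ≡ false
<ᵇ-asym zero (suc n) p = refl
<ᵇ-asym (suc m) (suc n) p = <ᵇ-asym m n p

thrAdj-sym : {n : ℕ} (bs : Vec Bool n) → ∀ i j → thrAdj bs i j ≡ thrAdj bs j i
thrAdj-sym bs i j with toℕ i <ᵇ toℕ j in e1 | toℕ j <ᵇ toℕ i in e2
... | true  | true  rewrite <ᵇ-asym (toℕ i) (toℕ j) e1 with e2
...   | ()
thrAdj-sym bs i j | true  | false = refl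
thrAdj-sym bs i j | false | true  = refl
thrAdj-sym bs i j | false | false = refl

thrAdj-irrefl : {n : ℕ} (bs : Vec Bool n) → ∀ i → thrAdj bs i i ≡ false
thrAdj-irrefl bs i rewrite <ᵇ-irrefl (toℕ i) = refl

thresholdGraph : {n : ℕ} → Vec Bool n → Graph n
thresholdGraph bs = record
  { adj = thrAdj bs ; sym = thrAdj-sym bs ; irrefl = thrAdj-irrefl bs }

IsThreshold : {n : ℕ} → Graph n → Set
IsThreshold {n} H = Σ (Vec Bool n) λ bs → Iso H (thresholdGraph bs)

{-# OPTIONS --safe #-}
-- If a_1..a_s, b_1..b_s witness sind(G) ≥ s, the vertices a_1, a_3, a_5, … together
-- with b_2, b_4, b_6, … induce R_⌊s/2⌋: for i ≤ j we have 2i-1 < 2j, so a_{2i-1} b_{2j}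
-- is an edge, while for i > j we have 2j < 2i-1, so b_{2j} a_{2i-1} is a non-edge.
-- Conversely the two sides of an induced R_k witness sind(G) ≥ k.  Every threshold graph
-- on k vertices is an induced subgraph of R_k, so a graph with sind(G) ≥ 2k contains
-- every threshold graph on k vertices.
module Submission where

open import Defs hiding (sym)
open import Data.Nat using (ℕ; _≤_; _<_; _*_; _/_)
open import Data.Product using (_×_)
open import Relation.Nullary using (¬_)

open import Data.Bool using (Bool; true; false; T; not)
open import Data.Bool.Properties using (T-≡)
open import Data.Empty using (⊥-elim)
open import Data.Fin using (Fin; toℕ; fromℕ<; splitAt; join; opposite; _≟_)
open import Data.Fin.Properties
  using (toℕ-injective; toℕ-fromℕ<; toℕ<n; splitAt-join; join-splitAt; opposite-prop; opposite-involutive)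
open import Data.Nat using (suc; _≤ᵇ_; _≡ᵇ_; s≤s)
open import Data.Nat.DivMod using (m/n*n≤m)
open import Data.Nat.Properties hiding (_≟_)
open import Data.Product using (_,_)
open import Data.Sum using (_⊎_; inj₁; inj₂; [_,_]; reduce)
open import Data.Sum.Properties using (inj₁-injective; inj₂-injective)
open import Data.Vec using (Vec; lookup)
open import Function using (_∘_; Equivalence)
open import Function.Definitions using (Injective)
open import Relation.Binary using (tri<; tri≈; tri>)
open import Relation.Binary.PropositionalEquality hiding ([_])
open import Relation.Nullary using (yes; no)

private
  variable
    k m n s : ℕ

T⇒≡true : ∀ {b} → T b → b ≡ true
T⇒≡true = Equivalence.to T-≡

¬T⇒≡false : ∀ {b} → ¬ T b → b ≡ false
¬T⇒≡false {true}  ¬t = ⊥-elim (¬t _)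
¬T⇒≡false {false} _  = refl

≤⇒≤ᵇ≡true : ∀ {i j} → i ≤ j → (i ≤ᵇ j) ≡ true
≤⇒≤ᵇ≡true = T⇒≡true ∘ ≤⇒≤ᵇ

>⇒≤ᵇ≡false : ∀ {i j} → j < i → (i ≤ᵇ j) ≡ false
>⇒≤ᵇ≡false {i} {j} j<i = ¬T⇒≡false (<⇒≱ j<i ∘ ≤ᵇ⇒≤ i j)

≢⇒≡ᵇ≡false : ∀ {i j} → i ≢ j → (i ≡ᵇ j) ≡ false
≢⇒≡ᵇ≡false {i} {j} i≢j = ¬T⇒≡false (i≢j ∘ ≡ᵇ⇒≡ i j)

InducedSub-trans : ∀ {a b c} {A : Graph a} {B : Graph b} {C : Graph c} →
                   InducedSub A B → InducedSub B C → InducedSub A C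
InducedSub-trans e f = record
  { emb     = F.emb ∘ E.emb
  ; emb-inj = E.emb-inj ∘ F.emb-inj
  ; emb-adj = λ x y → trans (E.emb-adj x y) (F.emb-adj _ _)
  }
  where module E = InducedSub e; module F = InducedSub f

Iso⇒InducedSub : {H G : Graph n} → Iso H G → InducedSub H G
Iso⇒InducedSub (f , f-inj , f-adj) = record { emb = f ; emb-inj = f-inj ; emb-adj = f-adj }

record RCopy (G : Graph n) (k : ℕ) : Set where
  field
    φ     : Fin k ⊎ Fin k → Fin n
    φ-inj : Injective _≡_ _≡_ φ
    φ-adj : ∀ u v → RAdj k u v ≡ adj G (φ u) (φ v)

join-injective : ∀ m n → Injective _≡_ _≡_ (join m n)
join-injective m n {x} {y} eq = begin
  x                      ≡⟨ splitAt-join m n x ⟨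
  splitAt m (join m n x) ≡⟨ cong (splitAt m) eq ⟩
  splitAt m (join m n y) ≡⟨ splitAt-join m n y ⟩
  y                      ∎
  where open ≡-Reasoning

splitAt-injective : ∀ m n → Injective _≡_ _≡_ (splitAt m {n})
splitAt-injective m n {x} {y} eq = begin
  x                      ≡⟨ join-splitAt m n x ⟨
  join m n (splitAt m x) ≡⟨ cong (join m n) eq ⟩
  join m n (splitAt m y) ≡⟨ join-splitAt m n y ⟩
  y                      ∎
  where open ≡-Reasoning

InducedR⇒RCopy : {G : Graph n} → HasInducedR G k → RCopy G k
InducedR⇒RCopy {k = k} e = record
  { φ     = emb ∘ join k k
  ; φ-inj = join-injective k k ∘ emb-inj
  ; φ-adj = λ u v → trans (sym (cong₂ (RAdj k) (splitAt-join k k u) (splitAt-join k k v)))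
                           (emb-adj (join k k u) (join k k v))
  }
  where open InducedSub e

RCopy⇒InducedR : {G : Graph n} → RCopy G k → HasInducedR G k
RCopy⇒InducedR {k = k} c = record
  { emb     = φ ∘ splitAt k
  ; emb-inj = splitAt-injective k k ∘ φ-inj
  ; emb-adj = λ x y → φ-adj (splitAt k x) (splitAt k y)
  }
  where open RCopy c

RCopy⇒SindWitness : {G : Graph n} → RCopy G k → SindWitness G k
RCopy⇒SindWitness {k = k} c = record
  { a         = φ ∘ inj₁
  ; b         = φ ∘ inj₂
  ; distinct  = sides-injective
  ; ab-adj    = λ i j i<j → trans (sym (φ-adj (inj₁ i) (inj₂ j))) (≤⇒≤ᵇ≡true (<⇒≤ i<j))
  ; ba-nonadj = λ i j i<j → trans (sym (φ-adj (inj₂ i) (inj₁ j))) (>⇒≤ᵇ≡false i<j)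
  ; a-clique  = λ i j i≢j → trans (sym (φ-adj (inj₁ i) (inj₁ j)))
                                  (cong not (≢⇒≡ᵇ≡false (i≢j ∘ toℕ-injective)))
  ; b-indep   = λ i j → sym (φ-adj (inj₂ i) (inj₂ j))
  }
  where
  open RCopy c
  sides-injective : Injective _≡_ _≡_ (λ x → [ φ ∘ inj₁ , φ ∘ inj₂ ] x)
  sides-injective {inj₁ _} {inj₁ _} = φ-inj
  sides-injective {inj₁ _} {inj₂ _} = φ-inj
  sides-injective {inj₂ _} {inj₁ _} = φ-inj
  sides-injective {inj₂ _} {inj₂ _} = φ-inj

module Interleave (2m≤s : 2 * m ≤ s) where

  odd<s : ∀ (i : Fin m) → suc (2 * toℕ i) < s
  odd<s i = ≤-trans (≤-reflexive (sym (*-suc 2 (toℕ i)))) (≤-trans (*-monoʳ-≤ 2 (toℕ<n i)) 2m≤s)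

  evenᶠ oddᶠ : Fin m → Fin s
  evenᶠ i = fromℕ< (<-trans (n<1+n (2 * toℕ i)) (odd<s i))
  oddᶠ  i = fromℕ< (odd<s i)

  toℕ-evenᶠ : ∀ i → toℕ (evenᶠ i) ≡ 2 * toℕ i
  toℕ-evenᶠ i = toℕ-fromℕ< _

  toℕ-oddᶠ : ∀ i → toℕ (oddᶠ i) ≡ suc (2 * toℕ i)
  toℕ-oddᶠ i = toℕ-fromℕ< _

  evenᶠ-injective : Injective _≡_ _≡_ evenᶠ
  evenᶠ-injective {i} {j} eq = toℕ-injective (*-cancelˡ-≡ (toℕ i) (toℕ j) 2
    (trans (sym (toℕ-evenᶠ i)) (trans (cong toℕ eq) (toℕ-evenᶠ j))))

  oddᶠ-injective : Injective _≡_ _≡_ oddᶠ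
  oddᶠ-injective {i} {j} eq = toℕ-injective (*-cancelˡ-≡ (toℕ i) (toℕ j) 2
    (suc-injective (trans (sym (toℕ-oddᶠ i)) (trans (cong toℕ eq) (toℕ-oddᶠ j)))))

  evenᶠ<oddᶠ : ∀ {i j} → toℕ i ≤ toℕ j → toℕ (evenᶠ i) < toℕ (oddᶠ j)
  evenᶠ<oddᶠ {i} {j} i≤j rewrite toℕ-evenᶠ i | toℕ-oddᶠ j = s≤s (*-monoʳ-≤ 2 i≤j)

  oddᶠ<evenᶠ : ∀ {i j} → toℕ j < toℕ i → toℕ (oddᶠ j) < toℕ (evenᶠ i)
  oddᶠ<evenᶠ {i} {j} j<i rewrite toℕ-evenᶠ i | toℕ-oddᶠ j =
    ≤-trans (≤-reflexive (sym (*-suc 2 (toℕ j)))) (*-monoʳ-≤ 2 j<i)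

  SindWitness⇒RCopy : {G : Graph n} → SindWitness G s → RCopy G m
  SindWitness⇒RCopy {G = G} W = record
    { φ     = [ a , b ] ∘ ι
    ; φ-inj = ι-injective ∘ distinct
    ; φ-adj = φ-adj
    }
    where
    open SindWitness W

    ι : Fin m ⊎ Fin m → Fin s ⊎ Fin s
    ι (inj₁ i) = inj₁ (evenᶠ i)
    ι (inj₂ j) = inj₂ (oddᶠ j)

    ι-injective : Injective _≡_ _≡_ ι
    ι-injective {inj₁ _} {inj₁ _} = cong inj₁ ∘ evenᶠ-injective ∘ inj₁-injective
    ι-injective {inj₁ _} {inj₂ _} ()
    ι-injective {inj₂ _} {inj₁ _} ()
    ι-injective {inj₂ _} {inj₂ _} = cong inj₂ ∘ oddᶠ-injective ∘ inj₂-injective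

    ab-adj-iff : ∀ i j → (toℕ i ≤ᵇ toℕ j) ≡ adj G (a (evenᶠ i)) (b (oddᶠ j))
    ab-adj-iff i j with toℕ i ≤? toℕ j
    ... | yes i≤j = trans (≤⇒≤ᵇ≡true i≤j) (sym (ab-adj _ _ (evenᶠ<oddᶠ i≤j)))
    ... | no  i≰j = trans (>⇒≤ᵇ≡false (≰⇒> i≰j))
                          (sym (trans (Graph.sym G _ _) (ba-nonadj _ _ (oddᶠ<evenᶠ (≰⇒> i≰j)))))

    φ-adj : ∀ u v → RAdj m u v ≡ adj G ([ a , b ] (ι u)) ([ a , b ] (ι v))
    φ-adj (inj₁ i) (inj₁ j) with i ≟ j
    ... | yes refl = trans (cong not (≡ᵇ-refl (toℕ i))) (sym (irrefl G _))
    ... | no  i≢j  = trans (cong not (≢⇒≡ᵇ≡false (i≢j ∘ toℕ-injective)))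
                           (sym (a-clique _ _ (i≢j ∘ evenᶠ-injective)))
    φ-adj (inj₁ i) (inj₂ j) = ab-adj-iff i j
    φ-adj (inj₂ i) (inj₁ j) = trans (ab-adj-iff j i) (Graph.sym G _ _)
    φ-adj (inj₂ i) (inj₂ j) = sym (b-indep _ _)

thrAdj-< : (bs : Vec Bool k) {i j : Fin k} → toℕ i < toℕ j → thrAdj bs i j ≡ lookup bs j
thrAdj-< bs {i} {j} i<j rewrite T⇒≡true (<⇒<ᵇ i<j) = refl

module ThresholdInR (bs : Vec Bool k) where

  side : Bool → Fin k → Fin k ⊎ Fin k
  side true  = inj₁
  side false = inj₂

  reduce-side : ∀ b i → reduce (side b i) ≡ i
  reduce-side true  i = refl
  reduce-side false i = refl

  -- Vertex v goes to a_{k-1-v} if it was added as universal and to b_{k-1-v} if isolated,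
  -- so later vertices get smaller indices.
  φ : Fin k → Fin k ⊎ Fin k
  φ v = side (lookup bs v) (opposite v)

  reduce-φ : ∀ v → reduce (φ v) ≡ opposite v
  reduce-φ v = reduce-side (lookup bs v) (opposite v)

  φ-injective : Injective _≡_ _≡_ φ
  φ-injective {u} {v} eq = begin
    u                       ≡⟨ opposite-involutive u ⟨
    opposite (opposite u)   ≡⟨ cong opposite (reduce-φ u) ⟨
    opposite (reduce (φ u)) ≡⟨ cong (opposite ∘ reduce) eq ⟩
    opposite (reduce (φ v)) ≡⟨ cong opposite (reduce-φ v) ⟩
    opposite (opposite v)   ≡⟨ opposite-involutive v ⟩
    v                       ∎
    where open ≡-Reasoning

  opposite-reverses-< : ∀ {i j : Fin k} → toℕ i < toℕ j → toℕ (opposite j) < toℕ (opposite i)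
  opposite-reverses-< {i} {j} i<j rewrite opposite-prop i | opposite-prop j =
    ∸-monoʳ-< (s≤s i<j) (toℕ<n j)

  φ-adj-< : ∀ {i j} → toℕ i < toℕ j → lookup bs j ≡ RAdj k (φ i) (φ j)
  φ-adj-< {i} {j} i<j with lookup bs i | lookup bs j
  ... | true  | true  = sym (cong not (≢⇒≡ᵇ≡false (<⇒≢ (opposite-reverses-< i<j) ∘ sym)))
  ... | true  | false = sym (>⇒≤ᵇ≡false (opposite-reverses-< i<j))
  ... | false | true  = sym (≤⇒≤ᵇ≡true (<⇒≤ (opposite-reverses-< i<j)))
  ... | false | false = refl

  φ-adj : ∀ i j → thrAdj bs i j ≡ RAdj k (φ i) (φ j)
  φ-adj i j with <-cmp (toℕ i) (toℕ j)
  ... | tri< i<j _ _ = trans (thrAdj-< bs i<j) (φ-adj-< i<j)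
  ... | tri≈ _ i≡j _ rewrite toℕ-injective {i = i} {j = j} i≡j =
    trans (thrAdj-irrefl bs j) (sym (RAdj-irrefl k (φ j)))
  ... | tri> _ _ j<i = trans (thrAdj-sym bs i j)
                             (trans (thrAdj-< bs j<i) (trans (φ-adj-< j<i) (RAdj-sym k (φ j) (φ i))))

  threshold⊆R : InducedSub (thresholdGraph bs) (R k)
  threshold⊆R = record
    { emb     = join k k ∘ φ
    ; emb-inj = φ-injective ∘ join-injective k k
    ; emb-adj = λ x y → trans (φ-adj x y)
        (sym (cong₂ (RAdj k) (splitAt-join k k (φ x)) (splitAt-join k k (φ y))))
    }

IsThreshold⇒InducedSub-R : {H : Graph k} → IsThreshold H → InducedSub H (R k)
IsThreshold⇒InducedSub-R (bs , iso) =
  InducedSub-trans (Iso⇒InducedSub iso) (ThresholdInR.threshold⊆R bs)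

fact4p3 : ∀ {n : ℕ} (G : Graph n) (r s : ℕ)
          → IsMax (HasInducedR G) r
          → IsMax (HasSind G) s
          → ((s / 2 ≤ r) × (r ≤ s))
            × (∀ (k : ℕ) (H : Graph k) → IsThreshold H → ¬ InducedSub H G → s < 2 * k)
fact4p3 G r s (Rᵣ⊆G , r-max) (sindₛ , s-max) =
  (r-max (s / 2) (R⊆G (s / 2) 2[s/2]≤s) , s-max r (RCopy⇒SindWitness (InducedR⇒RCopy Rᵣ⊆G)))
  , λ k H H-threshold H⊈G → ≰⇒> λ 2k≤s →
      H⊈G (InducedSub-trans (IsThreshold⇒InducedSub-R H-threshold) (R⊆G k 2k≤s))
  where
  R⊆G : ∀ m → 2 * m ≤ s → HasInducedR G m
  R⊆G m 2m≤s = RCopy⇒InducedR (Interleave.SindWitness⇒RCopy {m = m} 2m≤s sindₛ)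

  2[s/2]≤s : 2 * (s / 2) ≤ s
  2[s/2]≤s = subst (_≤ s) (*-comm (s / 2) 2) (m/n*n≤m s 2)
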